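{- Let $n\geq 1$ and $k\geq 0$ be integers, let $0\leq i\leq n-1$ and $0\leq j\leq k$, and define \[ i'=\Big\lfloor \frac{(n+1)k-(k+1)i-j}{k+1}\Big\rfloor,\qquad j'=(n+1)k-(k+1)i-j-(k+1)i'. \] Then the map $\varphi$ restricts to a bijection from $\Gamma^k(n,i;j)$ onto $\Gamma^k(n,i';j')$.
   Context: For a permutation $\pi=\pi_1\cdots\pi_n$ of $[n]=\{1,\dots,n\}$, $\mathrm{des}(\pi)$ is the number of $i\in[n-1]$ with $\pi_i>\pi_{i+1}$, and $\mathrm{maxdrop}(\pi)=\max\{i-\pi_i:1\leq i\leq n\}$. $A_{n,k}$ is the set of permutations of $[n]$ with $\mathrm{maxdrop}(\pi)\leq k$. For $0\leq i\leq n-1$, $0\leq j\leq k$, $\Gamma^k(n,i;j)$ is the set of $\pi\in A_{n,k}$ with $\mathrm{des}(\pi)=i$ and $\pi_n=n-k+j$. For a permutation $\sigma$ of $[m]$ and $1\leq c\leq m+1$, $\sigma\leftarrow c$ denotes the permutation of $[m+1]$ obtained by increasing by $1$ every entry of $\sigma$ that is $\geq c$ and then appending $c$ at the end (e.g. $3421\leftarrow 3=45213$). The map $\varphi:A_{n,k}\to A_{n,k}$ is defined recursively: $\varphi(1)=1$ for $n=1$; for $n\geq 2$ and $\pi\in A_{n,k}$, put $i=\mathrm{des}(\pi)$, $j=\pi_n-n+k$, $i'=\lfloor((n+1)k-(k+1)i-j)/(k+1)\rfloor$, $j'=(n+1)k-(k+1)i-j-(k+1)i'$, let $\pi'$ be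 the permutation of $[n-1]$ order-isomorphic to $\pi_1\cdots\pi_{n-1}$ (so $\pi=\pi'\leftarrow\pi_n$), and set $\varphi(\pi)=\varphi(\pi')\leftarrow(n-k+j')$. -}

module Defs where

open import Data.Nat as ℕ using (ℕ; zero; suc; _≤_; _<ᵇ_; _≤ᵇ_; _⊔_; _∸_)
open import Data.Integer as ℤ using (ℤ; +_; ∣_∣)
open import Data.Integer.DivMod using (_/ℕ_)
open import Data.Bool using (if_then_else_)
open import Data.List using (List; []; _∷_; _++_; [_]; map; applyUpTo; length)
open import Data.List.Relation.Binary.Permutation.Propositional using (_↭_)
open import Data.Product using (_×_)
open import Relation.Binary.PropositionalEquality using (_≡_)

range : ℕ → List ℕ
range n = applyUpTo suc n

-- a permutation of [n] in one-line notation π₁ ⋯ πₙ (a list of naturals)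
IsPerm : ℕ → List ℕ → Set
IsPerm n π = π ↭ range n

des : List ℕ → ℕ
des []           = 0
des (x ∷ [])     = 0
des (x ∷ y ∷ xs) = (if y <ᵇ x then 1 else 0) ℕ.+ des (y ∷ xs)

-- maxdrop π = max { i - π_i }, positions counted from a given start index.
-- (Truncated subtraction is harmless: for a permutation the true maximum is ≥ 0.)
maxdropFrom : ℕ → List ℕ → ℕ
maxdropFrom i []       = 0
maxdropFrom i (x ∷ xs) = (i ∸ x) ⊔ maxdropFrom (suc i) xs

maxdrop : List ℕ → ℕ
maxdrop π = maxdropFrom 1 π

InA : ℕ → ℕ → List ℕ → Set
InA n k π = IsPerm n π × maxdrop π ≤ k

-- last entry π_n (0 for the empty list, never used on it)
lastOr0 : List ℕ → ℕ
lastOr0 []           = 0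
lastOr0 (x ∷ [])     = x
lastOr0 (x ∷ y ∷ xs) = lastOr0 (y ∷ xs)

init : List ℕ → List ℕ
init []           = []
init (x ∷ [])     = []
init (x ∷ y ∷ xs) = x ∷ init (y ∷ xs)

-- Γ^k(n,i;j) as a predicate; i and j are integers so that the target
-- parameters i', j' (which are integers in general) can be used directly:
-- π ∈ A_{n,k}, des π = i, π_n = n - k + j.
InΓ : (k n : ℕ) → ℤ → ℤ → List ℕ → Set
InΓ k n i j π = InA n k π × (+ des π ≡ i) × (+ lastOr0 π ≡ (+ n ℤ.- + k) ℤ.+ j)

_←_ : List ℕ → ℕ → List ℕ
σ ← c = map (λ x → if c ≤ᵇ x then suc x else x) σ ++ [ c ]

-- the permutation order-isomorphic to π₁ ⋯ π_{n-1} (π a permutation)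
std : List ℕ → List ℕ
std π = map (λ x → if lastOr0 π <ᵇ x then x ∸ 1 else x) (init π)

bigN : (k n : ℕ) → ℤ → ℤ → ℤ
bigN k n i j = + (suc n ℕ.* k) ℤ.- + (suc k) ℤ.* i ℤ.- j

i′ : (k n : ℕ) → ℤ → ℤ → ℤ
i′ k n i j = bigN k n i j /ℕ suc k

j′ : (k n : ℕ) → ℤ → ℤ → ℤ
j′ k n i j = bigN k n i j ℤ.- + (suc k) ℤ.* i′ k n i j

-- The new last entry n - k + j' is converted to ℕ via ∣_∣; on A_{n,k} it is
-- a value in [n] (this is part of what the theorem asserts).
φ : (k n : ℕ) → List ℕ → List ℕ
φ k zero          π = []
φ k (suc zero)    π = 1 ∷ []
φ k (suc (suc m)) π =
  φ k (suc m) (std π) ← ∣ (+ n ℤ.- + k) ℤ.+ j′ k n (+ des π) j ∣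
  where
  n = suc (suc m)
  j = + lastOr0 π ℤ.- + n ℤ.+ + k

-- Put j(π) = π_n − n + k and w(π) = (k+1)·des(π) + j(π), so that w = (k+1)i + j on Γ^k(n,i;j).
-- By induction on n, φ is an involution of A_{n,k} with w(φ π) + w(π) = (n+1)k. As 0 ≤ j ≤ k,
-- (i', j') is then the quotient and remainder of w(φ π) = (n+1)k − w(π) by k+1, so φ maps
-- Γ^k(n,i;j) into Γ^k(n,i';j'), and onto it because φ is its own inverse.
-- In the inductive step π = σ ← c, and appending c to σ (whose last entry is a) changes the weight
-- by k − t, where t ≡ a − c (mod k+1) lies in [0, k]. Then φ π = φ σ ← c', where c' is chosen with
-- offset k − t against the last entry of φ σ, so the two weight changes add up to k. That c' ≥ 1
-- is automatic for k < n; for k ≥ n the invariant forces the last entries of σ and φ σ to sum to n,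
-- which makes c' = n + 1 − c.
module Submission where

open import Defs
open import Data.Bool using (Bool; if_then_else_)
open import Data.Integer as ℤ using (ℤ; +_; ∣_∣)
import Data.Integer.Properties as ℤ
import Data.Integer.Tactic.RingSolver as ℤ-Solver
open import Data.List using (List; []; _∷_; _++_; [_]; map; length; applyUpTo)
open import Data.List.Properties using (map-++; ++-assoc; length-++; length-map; map-∘; map-cong; map-id; map-id-local; ++-identityʳ; length-applyUpTo)
open import Data.List.Membership.Propositional using (_∈_)
open import Data.List.Membership.Propositional.Properties using (∈-++⁺ʳ; ∈-++⁻)
import Data.List.Relation.Unary.All as All
open import Data.List.Relation.Unary.Any using (here; there)
open import Data.List.Relation.Binary.Permutation.Propositional using (_↭_; ↭-refl; ↭-trans; ↭-reflexive; module PermutationReasoning)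
open import Data.List.Relation.Binary.Permutation.Propositional.Properties using (map⁺; ++⁺ˡ; ++⁺ʳ; drop-mid; ∈-resp-↭; ↭-length; ↭-singleton-inv; ++-comm)
open import Data.Nat as ℕ using (ℕ; NonZero; zero; suc; _≤_; _<_; _≤?_; _<?_; _≤ᵇ_; _<ᵇ_; _⊔_; _∸_; _+_; _*_; z≤n; s≤s; s≤s⁻¹)
open import Data.Nat.DivMod using (_/_; /-congˡ; +-distrib-/-∣ˡ; m*n/n≡m; m<n⇒m/n≡0)
open import Data.Nat.Divisibility using (m∣m*n)
open import Data.Nat.Properties
open import Data.Nat.Tactic.RingSolver using (solve)
open import Data.Product using (_×_; _,_; Σ; ∃; proj₁; proj₂)
open import Data.Sum using (inj₁; inj₂)
open import Function using (_∘_)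
open import Relation.Nullary using (¬_; yes; no; contradiction)
open import Relation.Nullary.Decidable using (dec-true; dec-false)
open import Relation.Binary.PropositionalEquality hiding ([_])

-- l ≡ r follows from s ≡ t whenever l − r = s − t, a ring identity left to the solver.
linear-combination : ∀ {l r s t} → s ≡ t → l + t ≡ r + s → l ≡ r
linear-combination {l} {r} {s} {t} s≡t l+t≡r+s = +-cancelʳ-≡ t l r (trans l+t≡r+s (cong (r ℕ.+_) s≡t))

ℤ-linear-combination : ∀ {l r s t : ℤ} → s ≡ t → l ℤ.+ t ≡ r ℤ.+ s → l ≡ r
ℤ-linear-combination {l} {r} {s} {t} s≡t l+t≡r+s = begin
  l              ≡⟨ x+y-y≡x l t ⟨
  l ℤ.+ t ℤ.- t  ≡⟨ cong (ℤ._- t) (trans l+t≡r+s (cong (λ x → r ℤ.+ x) s≡t)) ⟩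
  r ℤ.+ t ℤ.- t  ≡⟨ x+y-y≡x r t ⟩
  r              ∎
  where
  open ≡-Reasoning
  x+y-y≡x : ∀ x y → x ℤ.+ y ℤ.- y ≡ x
  x+y-y≡x = ℤ-Solver.solve-∀

[m*n+o]/m≡n : ∀ m n {o} .{{_ : NonZero m}} → o < m → (m * n + o) / m ≡ n
[m*n+o]/m≡n m n {o} o<m = begin
  (m * n + o) / m    ≡⟨ +-distrib-/-∣ˡ o (m∣m*n n) ⟩
  m * n / m + o / m  ≡⟨ cong₂ _+_ (trans (/-congˡ (*-comm m n)) (m*n/n≡m n m)) (m<n⇒m/n≡0 o<m) ⟩
  n + 0              ≡⟨ +-identityʳ n ⟩
  n                  ∎
  where open ≡-Reasoning

divmod-unique : ∀ m .{{_ : NonZero m}} {q q′ r r′} → r < m → r′ < m → m * q + r ≡ m * q′ + r′ → q ≡ q′ × r ≡ r′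
divmod-unique m {q} {q′} {r} {r′} r<m r′<m eq = q≡q′ , +-cancelˡ-≡ (m * q) r r′ (trans eq (cong (λ x → m * x + r′) (sym q≡q′)))
  where
  q≡q′ : q ≡ q′
  q≡q′ = trans (sym ([m*n+o]/m≡n m q r<m)) (trans (/-congˡ eq) ([m*n+o]/m≡n m q′ r′<m))

pos-*-+ : ∀ a b c → + (a * b + c) ≡ + a ℤ.* + b ℤ.+ + c
pos-*-+ a b c = cong (ℤ._+ + c) (ℤ.pos-* a b)

toℕ : Bool → ℕ
toℕ b = if b then 1 else 0

toℕ-≤ᵇ-yes : ∀ {m n} → m ≤ n → toℕ (m ≤ᵇ n) ≡ 1
toℕ-≤ᵇ-yes {m} {n} m≤n = cong toℕ (dec-true (m ≤? n) m≤n)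

toℕ-≤ᵇ-no : ∀ {m n} → ¬ m ≤ n → toℕ (m ≤ᵇ n) ≡ 0
toℕ-≤ᵇ-no {m} {n} m≰n = cong toℕ (dec-false (m ≤? n) m≰n)

-- σ ← c unfolds to map (shiftUp c) σ ++ [ c ], and std π to map (shiftDown (lastOr0 π)) (init π).
shiftUp : ℕ → ℕ → ℕ
shiftUp c x = if c ≤ᵇ x then suc x else x

shiftDown : ℕ → ℕ → ℕ
shiftDown c x = if c <ᵇ x then x ∸ 1 else x

module _ {c x : ℕ} where

  shiftUp-≥ : c ≤ x → shiftUp c x ≡ suc x
  shiftUp-≥ c≤x = cong (if_then suc x else x) (dec-true (c ≤? x) c≤x)

  shiftUp-< : x < c → shiftUp c x ≡ x
  shiftUp-< x<c = cong (if_then suc x else x) (dec-false (c ≤? x) (<⇒≱ x<c))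

  shiftDown-> : c < x → shiftDown c x ≡ x ∸ 1
  shiftDown-> c<x = cong (if_then x ∸ 1 else x) (dec-true (c <? x) c<x)

  shiftDown-≤ : x ≤ c → shiftDown c x ≡ x
  shiftDown-≤ x≤c = cong (if_then x ∸ 1 else x) (dec-false (c <? x) (≤⇒≯ x≤c))

shiftDown-shiftUp : ∀ c x → shiftDown c (shiftUp c x) ≡ x
shiftDown-shiftUp c x with c ≤? x
... | yes c≤x rewrite shiftUp-≥ c≤x = shiftDown-> (s≤s c≤x)
... | no c≰x  rewrite shiftUp-< (≰⇒> c≰x) = shiftDown-≤ (<⇒≤ (≰⇒> c≰x))

shiftUp-shiftDown : ∀ {c x} → c < x → shiftUp c (shiftDown c x) ≡ x
shiftUp-shiftDown {c} {suc x} c<x rewrite shiftDown-> c<x = shiftUp-≥ (s≤s⁻¹ c<x)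

x≤shiftUp : ∀ c x → x ≤ shiftUp c x
x≤shiftUp c x with c ≤? x
... | yes c≤x rewrite shiftUp-≥ c≤x = n≤1+n x
... | no c≰x  rewrite shiftUp-< (≰⇒> c≰x) = ≤-refl

shiftUp-mono-≤ : ∀ c {x y} → x ≤ y → shiftUp c x ≤ shiftUp c y
shiftUp-mono-≤ c {x} {y} x≤y with c ≤? x
... | yes c≤x rewrite shiftUp-≥ c≤x | shiftUp-≥ (≤-trans c≤x x≤y) = s≤s x≤y
... | no c≰x  rewrite shiftUp-< (≰⇒> c≰x) = ≤-trans x≤y (x≤shiftUp c y)

shiftUp-mono-< : ∀ c {x y} → x < y → shiftUp c x < shiftUp c y
shiftUp-mono-< c {x} {y} x<y with c ≤? x
... | yes c≤x rewrite shiftUp-≥ c≤x | shiftUp-≥ (≤-trans c≤x (<⇒≤ x<y)) = s≤s x<y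
... | no c≰x  rewrite shiftUp-< (≰⇒> c≰x) = ≤-trans x<y (x≤shiftUp c y)

shiftUp-<ᵇ : ∀ c x y → (shiftUp c x <ᵇ shiftUp c y) ≡ (x <ᵇ y)
shiftUp-<ᵇ c x y with x <? y
... | yes x<y = trans (dec-true (shiftUp c x <? shiftUp c y) (shiftUp-mono-< c x<y)) (sym (dec-true (x <? y) x<y))
... | no x≮y  = trans (dec-false (shiftUp c x <? shiftUp c y) (≤⇒≯ (shiftUp-mono-≤ c (≮⇒≥ x≮y)))) (sym (dec-false (x <? y) x≮y))

<ᵇ-shiftUp : ∀ c x → (c <ᵇ shiftUp c x) ≡ (c ≤ᵇ x)
<ᵇ-shiftUp c x with c ≤? x
... | yes c≤x rewrite shiftUp-≥ c≤x = trans (dec-true (c <? suc x) (s≤s c≤x)) (sym (dec-true (c ≤? x) c≤x))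
... | no c≰x  rewrite shiftUp-< (≰⇒> c≰x) = trans (dec-false (c <? x) (c≰x ∘ <⇒≤)) (sym (dec-false (c ≤? x) c≰x))

interval : ℕ → ℕ → List ℕ
interval a zero    = []
interval a (suc n) = a ∷ interval (suc a) n

applyUpTo-interval : ∀ n (f : ℕ → ℕ) a → (∀ i → f i ≡ a + i) → applyUpTo f n ≡ interval a n
applyUpTo-interval zero    f a f≗a+ = refl
applyUpTo-interval (suc n) f a f≗a+ = cong₂ _∷_ (trans (f≗a+ 0) (+-identityʳ a))
  (applyUpTo-interval n (f ∘ suc) (suc a) (λ i → trans (f≗a+ (suc i)) (+-suc a i)))

range≡interval : ∀ n → range n ≡ interval 1 n
range≡interval n = applyUpTo-interval n suc 1 (λ _ → refl)

interval-++ : ∀ a m n → interval a (m + n) ≡ interval a m ++ interval (a + m) n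
interval-++ a zero    n = cong (λ b → interval b n) (sym (+-identityʳ a))
interval-++ a (suc m) n = cong (a ∷_) (trans (interval-++ (suc a) m n)
  (cong (λ b → interval (suc a) m ++ interval b n) (sym (+-suc a m))))

∈-interval : ∀ {x} a n → x ∈ interval a n → a ≤ x × x < a + n
∈-interval a (suc n) (here refl) = ≤-refl , m<m+n a (s≤s z≤n)
∈-interval a (suc n) (there x∈) with ∈-interval (suc a) n x∈
... | a<x , x<1+a+n = <⇒≤ a<x , ≤-trans x<1+a+n (≤-reflexive (sym (+-suc a n)))

map-shiftUp-below : ∀ c a n → a + n ≤ c → map (shiftUp c) (interval a n) ≡ interval a n
map-shiftUp-below c a zero    _     = refl
map-shiftUp-below c a (suc n) a+n≤c = cong₂ _∷_ (shiftUp-< (≤-trans (s≤s (m≤m+n a n)) a+n≤c′))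
  (map-shiftUp-below c (suc a) n a+n≤c′)
  where
  a+n≤c′ : suc a + n ≤ c
  a+n≤c′ = ≤-trans (≤-reflexive (sym (+-suc a n))) a+n≤c

map-shiftUp-above : ∀ c a n → c ≤ a → map (shiftUp c) (interval a n) ≡ interval (suc a) n
map-shiftUp-above c a zero    _   = refl
map-shiftUp-above c a (suc n) c≤a = cong₂ _∷_ (shiftUp-≥ c≤a) (map-shiftUp-above c (suc a) n (m≤n⇒m≤1+n c≤a))

map-shiftDown-below : ∀ c a n → a + n ≤ suc c → map (shiftDown c) (interval a n) ≡ interval a n
map-shiftDown-below c a zero    _      = refl
map-shiftDown-below c a (suc n) a+n≤1+c = cong₂ _∷_ (shiftDown-≤ (s≤s⁻¹ (≤-trans (s≤s (m≤m+n a n)) a+n≤1+c′)))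
  (map-shiftDown-below c (suc a) n a+n≤1+c′)
  where
  a+n≤1+c′ : suc a + n ≤ suc c
  a+n≤1+c′ = ≤-trans (≤-reflexive (sym (+-suc a n))) a+n≤1+c

map-shiftDown-above : ∀ c a n → c ≤ a → map (shiftDown c) (interval (suc a) n) ≡ interval a n
map-shiftDown-above c a zero    _   = refl
map-shiftDown-above c a (suc n) c≤a = cong₂ _∷_ (shiftDown-> (s≤s c≤a)) (map-shiftDown-above c (suc a) n (m≤n⇒m≤1+n c≤a))

lastOr0-++ : ∀ (xs : List ℕ) c → lastOr0 (xs ++ [ c ]) ≡ c
lastOr0-++ []           c = refl
lastOr0-++ (x ∷ [])     c = refl
lastOr0-++ (x ∷ y ∷ xs) c = lastOr0-++ (y ∷ xs) c

init-++ : ∀ (xs : List ℕ) c → init (xs ++ [ c ]) ≡ xs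
init-++ []           c = refl
init-++ (x ∷ [])     c = refl
init-++ (x ∷ y ∷ xs) c = cong (x ∷_) (init-++ (y ∷ xs) c)

init-++-lastOr0 : ∀ x (xs : List ℕ) → init (x ∷ xs) ++ [ lastOr0 (x ∷ xs) ] ≡ x ∷ xs
init-++-lastOr0 x []       = refl
init-++-lastOr0 x (y ∷ xs) = cong (x ∷_) (init-++-lastOr0 y xs)

lastOr0-map : ∀ (f : ℕ → ℕ) x xs → lastOr0 (map f (x ∷ xs)) ≡ f (lastOr0 (x ∷ xs))
lastOr0-map f x []       = refl
lastOr0-map f x (y ∷ xs) = lastOr0-map f y xs

std-← : ∀ σ c → std (σ ← c) ≡ σ
std-← σ c rewrite lastOr0-++ (map (shiftUp c) σ) c | init-++ (map (shiftUp c) σ) c =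
  trans (sym (map-∘ σ)) (trans (map-cong (shiftDown-shiftUp c) σ) (map-id σ))

←-↭ : ∀ p q σ → σ ↭ interval 1 (p + q) → σ ← suc p ↭ interval 1 (p + suc q)
←-↭ p q σ σ↭ = begin
  map (shiftUp c) σ ++ [ c ]                     ↭⟨ ++⁺ʳ [ c ] (map⁺ (shiftUp c) σ↭) ⟩
  map (shiftUp c) (interval 1 (p + q)) ++ [ c ]  ≡⟨ cong (_++ [ c ]) shifted ⟩
  (interval 1 p ++ interval (suc c) q) ++ [ c ]  ≡⟨ ++-assoc (interval 1 p) _ _ ⟩
  interval 1 p ++ interval (suc c) q ++ [ c ]    ↭⟨ ++⁺ˡ (interval 1 p) (++-comm (interval (suc c) q) [ c ]) ⟩
  interval 1 p ++ interval c (suc q)             ≡⟨ interval-++ 1 p (suc q) ⟨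
  interval 1 (p + suc q)                         ∎
  where
  open PermutationReasoning
  c : ℕ
  c = suc p
  shifted : map (shiftUp c) (interval 1 (p + q)) ≡ interval 1 p ++ interval (suc c) q
  shifted = trans (cong (map (shiftUp c)) (interval-++ 1 p q))
    (trans (map-++ (shiftUp c) (interval 1 p) (interval c q))
      (cong₂ _++_ (map-shiftUp-below c 1 p ≤-refl) (map-shiftUp-above c c q ≤-refl)))

module _ {xs : List ℕ} {p q : ℕ} (xs↭ : xs ++ [ suc p ] ↭ interval 1 (p + suc q)) where

  private
    c : ℕ
    c = suc p

    xs↭-split : xs ↭ interval 1 p ++ interval (suc c) q
    xs↭-split = ↭-trans (↭-reflexive (sym (++-identityʳ xs)))
      (drop-mid xs (interval 1 p) (↭-trans xs↭ (↭-reflexive (interval-++ 1 p (suc q)))))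

  shiftDown-↭ : map (shiftDown c) xs ↭ interval 1 (p + q)
  shiftDown-↭ = ↭-trans (map⁺ (shiftDown c) xs↭-split) (↭-reflexive (begin
    map (shiftDown c) (interval 1 p ++ interval (suc c) q)
      ≡⟨ map-++ (shiftDown c) (interval 1 p) (interval (suc c) q) ⟩
    map (shiftDown c) (interval 1 p) ++ map (shiftDown c) (interval (suc c) q)
      ≡⟨ cong₂ _++_ (map-shiftDown-below c 1 p (n≤1+n c)) (map-shiftDown-above c c q ≤-refl) ⟩
    interval 1 p ++ interval c q
      ≡⟨ interval-++ 1 p q ⟨
    interval 1 (p + q) ∎))
    where open ≡-Reasoning

  shiftUp-shiftDown-↭ : map (shiftUp c) (map (shiftDown c) xs) ≡ xs
  shiftUp-shiftDown-↭ = trans (sym (map-∘ xs)) (map-id-local (All.tabulate shiftUp-shiftDown-on))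
    where
    shiftUp-shiftDown-on : ∀ {x} → x ∈ xs → shiftUp c (shiftDown c x) ≡ x
    shiftUp-shiftDown-on x∈ with ∈-++⁻ (interval 1 p) (∈-resp-↭ xs↭-split x∈)
    ... | inj₁ x∈lo = let _ , x<c = ∈-interval 1 p x∈lo in
      trans (cong (shiftUp c) (shiftDown-≤ (<⇒≤ x<c))) (shiftUp-< x<c)
    ... | inj₂ x∈hi = shiftUp-shiftDown (proj₁ (∈-interval (suc c) q x∈hi))

maxdropFrom-++ : ∀ i (xs ys : List ℕ) → maxdropFrom i (xs ++ ys) ≡ maxdropFrom i xs ⊔ maxdropFrom (i + length xs) ys
maxdropFrom-++ i []       ys = cong (λ j → maxdropFrom j ys) (sym (+-identityʳ i))
maxdropFrom-++ i (x ∷ xs) ys = trans (cong ((i ∸ x) ⊔_) (maxdropFrom-++ (suc i) xs ys))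
  (trans (sym (⊔-assoc (i ∸ x) _ _))
    (cong (λ j → (i ∸ x) ⊔ maxdropFrom (suc i) xs ⊔ maxdropFrom j ys) (sym (+-suc i (length xs)))))

maxdropFrom-shiftUp : ∀ c i xs → maxdropFrom i (map (shiftUp c) xs) ≤ maxdropFrom i xs
maxdropFrom-shiftUp c i []       = ≤-refl
maxdropFrom-shiftUp c i (x ∷ xs) = ⊔-mono-≤ (∸-monoʳ-≤ i (x≤shiftUp c x)) (maxdropFrom-shiftUp c (suc i) xs)

maxdropFrom-shiftDown : ∀ k c i xs → maxdropFrom i xs ≤ k → i + length xs ≤ suc (c + k) →
  maxdropFrom i (map (shiftDown c) xs) ≤ k
maxdropFrom-shiftDown k c i []       _    _     = z≤n
maxdropFrom-shiftDown k c i (x ∷ xs) md≤k i+l≤ = ⊔-lub head-drop≤k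
  (maxdropFrom-shiftDown k c (suc i) xs (m⊔n≤o⇒n≤o (i ∸ x) _ md≤k) i+l≤′)
  where
  i+l≤′ : suc i + length xs ≤ suc (c + k)
  i+l≤′ = ≤-trans (≤-reflexive (sym (+-suc i (length xs)))) i+l≤
  i≤c+k : i ≤ c + k
  i≤c+k = s≤s⁻¹ (≤-trans (s≤s (m≤m+n i (length xs))) i+l≤′)
  head-drop≤k : i ∸ shiftDown c x ≤ k
  head-drop≤k with c <? x
  ... | yes c<x rewrite shiftDown-> c<x = ≤-trans (∸-monoʳ-≤ i (pred-mono-≤ c<x)) (m≤n+o⇒m∸n≤o i c i≤c+k)
  ... | no c≮x  rewrite shiftDown-≤ (≮⇒≥ c≮x) = m⊔n≤o⇒m≤o (i ∸ x) _ md≤k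

length-↭-range : ∀ {σ n} → σ ↭ range n → length σ ≡ n
length-↭-range {n = n} σ↭ = trans (↭-length σ↭) (length-applyUpTo suc n)

-- The possible last entries c = n − k + j (0 ≤ j ≤ k) of permutations in A_{n,k}.
record Admissible (k n c : ℕ) : Set where
  constructor admissible
  field
    1≤c   : 1 ≤ c
    c≤n   : c ≤ n
    n≤c+k : n ≤ c + k

←-∈A : ∀ {k m σ c} → InA m k σ → Admissible k (suc m) c → InA (suc m) k (σ ← c)
←-∈A {k} {m} {σ} {suc p} (σ↭ , σ-md) (admissible _ c≤1+m 1+m≤c+k) = perm , drop
  where
  q : ℕ
  q = m ∸ p
  p+q≡m : p + q ≡ m
  p+q≡m = m+[n∸m]≡n (s≤s⁻¹ c≤1+m)
  perm : σ ← suc p ↭ range (suc m)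
  perm = subst (σ ← suc p ↭_)
    (trans (cong (interval 1) (trans (+-suc p q) (cong suc p+q≡m))) (sym (range≡interval (suc m))))
    (←-↭ p q σ (subst (σ ↭_) (trans (range≡interval m) (cong (interval 1) (sym p+q≡m))) σ↭))
  last-drop : 1 + length (map (shiftUp (suc p)) σ) ≤ suc p + k
  last-drop rewrite length-map (shiftUp (suc p)) σ | length-↭-range σ↭ = 1+m≤c+k
  drop : maxdrop (σ ← suc p) ≤ k
  drop rewrite maxdropFrom-++ 1 (map (shiftUp (suc p)) σ) [ suc p ] =
    ⊔-lub (≤-trans (maxdropFrom-shiftUp (suc p) 1 σ) σ-md) (⊔-lub (m≤n+o⇒m∸n≤o _ (suc p) last-drop) z≤n)

snoc-decompose : ∀ {k m} xs c → InA (suc m) k (xs ++ [ c ]) →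
  InA m k (map (shiftDown c) xs) × Admissible k (suc m) c × map (shiftUp c) (map (shiftDown c) xs) ≡ xs
snoc-decompose {k} {m} xs c (π↭ , π-md)
  with ∈-interval 1 (suc m) (subst (c ∈_) (range≡interval (suc m)) (∈-resp-↭ π↭ (∈-++⁺ʳ xs (here refl))))
snoc-decompose {k} {m} xs (suc p) (π↭ , π-md) | 1≤c , c≤1+m =
  (subst (map (shiftDown (suc p)) xs ↭_) (trans (cong (interval 1) p+q≡m) (sym (range≡interval m))) (shiftDown-↭ xs↭)
    , maxdropFrom-shiftDown k (suc p) 1 xs (m⊔n≤o⇒m≤o (maxdropFrom 1 xs) _ drops) (≤-trans 1+l≤c+k (n≤1+n _)))
  , admissible 1≤c (s≤s⁻¹ c≤1+m) 1+m≤c+k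
  , shiftUp-shiftDown-↭ xs↭
  where
  q : ℕ
  q = m ∸ p
  p+q≡m : p + q ≡ m
  p+q≡m = m+[n∸m]≡n (s≤s⁻¹ (s≤s⁻¹ c≤1+m))
  xs↭ : xs ++ [ suc p ] ↭ interval 1 (p + suc q)
  xs↭ = subst (xs ++ [ suc p ] ↭_) (trans (range≡interval (suc m)) (cong (interval 1) (sym (trans (+-suc p q) (cong suc p+q≡m))))) π↭
  length-xs : length xs ≡ m
  length-xs = suc-injective (trans (+-comm 1 (length xs)) (trans (sym (length-++ xs)) (length-↭-range π↭)))
  drops : maxdropFrom 1 xs ⊔ ((1 + length xs ∸ suc p) ⊔ 0) ≤ k
  drops = subst (_≤ k) (maxdropFrom-++ 1 xs [ suc p ]) π-md
  1+l≤c+k : 1 + length xs ≤ suc p + k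
  1+l≤c+k = ≤-trans (m≤n+m∸n (1 + length xs) (suc p)) (+-monoʳ-≤ (suc p) (m⊔n≤o⇒m≤o _ 0 (m⊔n≤o⇒n≤o (maxdropFrom 1 xs) _ drops)))
  1+m≤c+k : suc m ≤ suc p + k
  1+m≤c+k = subst (λ l → suc l ≤ suc p + k) length-xs 1+l≤c+k

∈A-decompose : ∀ {k m π} → InA (suc m) k π →
  InA m k (std π) × Admissible k (suc m) (lastOr0 π) × std π ← lastOr0 π ≡ π
∈A-decompose {π = []} (π↭ , _) with length-↭-range π↭
... | ()
∈A-decompose {k} {m} {x ∷ xs} π∈A
  with snoc-decompose (init (x ∷ xs)) (lastOr0 (x ∷ xs)) (subst (InA (suc m) k) (sym (init-++-lastOr0 x xs)) π∈A)
... | std∈A , adm , shifts-back = std∈A , adm , trans (cong (_++ [ lastOr0 (x ∷ xs) ]) shifts-back) (init-++-lastOr0 x xs)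

last-admissible : ∀ {k m π} → InA (suc m) k π → Admissible k (suc m) (lastOr0 π)
last-admissible π∈A = proj₁ (proj₂ (∈A-decompose π∈A))

des-shiftUp : ∀ c xs → des (map (shiftUp c) xs) ≡ des xs
des-shiftUp c []           = refl
des-shiftUp c (x ∷ [])     = refl
des-shiftUp c (x ∷ y ∷ xs) = cong₂ (λ b d → toℕ b + d) (shiftUp-<ᵇ c y x) (des-shiftUp c (y ∷ xs))

des-++-[] : ∀ x xs c → des ((x ∷ xs) ++ [ c ]) ≡ des (x ∷ xs) + toℕ (c <ᵇ lastOr0 (x ∷ xs))
des-++-[] x []       c = +-identityʳ _
des-++-[] x (y ∷ xs) c = trans (cong (toℕ (y <ᵇ x) ℕ.+_) (des-++-[] y xs c)) (sym (+-assoc (toℕ (y <ᵇ x)) _ _))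

des-← : ∀ x xs c → des ((x ∷ xs) ← c) ≡ des (x ∷ xs) + toℕ (c ≤ᵇ lastOr0 (x ∷ xs))
des-← x xs c = trans (des-++-[] (shiftUp c x) (map (shiftUp c) xs) c)
  (cong₂ (λ d b → d + toℕ b) (des-shiftUp c (x ∷ xs))
    (trans (cong (c <ᵇ_) (lastOr0-map (shiftUp c) x xs)) (<ᵇ-shiftUp c _)))

jIndex : ℕ → ℕ → List ℕ → ℕ
jIndex k n π = lastOr0 π + k ∸ n

weight : ℕ → ℕ → List ℕ → ℕ
weight k n π = suc k * des π + jIndex k n π

module _ {k n c : ℕ} (adm : Admissible k n c) where

  open Admissible adm

  c+k≡n+[c+k∸n] : c + k ≡ n + (c + k ∸ n)
  c+k≡n+[c+k∸n] = sym (m+[n∸m]≡n n≤c+k)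

  c+k∸n≤k : c + k ∸ n ≤ k
  c+k∸n≤k = m≤n+o⇒m∸n≤o (c + k) n (+-monoˡ-≤ k c≤n)

  private
    c+k≡n+[c+k∸n]-ℤ : + c ℤ.+ + k ≡ + n ℤ.+ + (c + k ∸ n)
    c+k≡n+[c+k∸n]-ℤ = cong +_ c+k≡n+[c+k∸n]

  n-k+[c+k∸n]≡c : (+ n ℤ.- + k) ℤ.+ + (c + k ∸ n) ≡ + c
  n-k+[c+k∸n]≡c = rearrange {+ c} {+ n} {+ k} c+k≡n+[c+k∸n]-ℤ
    where
    rearrange : ∀ {c n k j : ℤ} → c ℤ.+ k ≡ n ℤ.+ j → n ℤ.- k ℤ.+ j ≡ c
    rearrange {c} {n} {k} {j} eq = ℤ-linear-combination (sym eq) (ℤ-Solver.solve (c ∷ n ∷ k ∷ j ∷ []))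

  c-n+k≡c+k∸n : + c ℤ.- + n ℤ.+ + k ≡ + (c + k ∸ n)
  c-n+k≡c+k∸n = rearrange {+ c} {+ n} {+ k} c+k≡n+[c+k∸n]-ℤ
    where
    rearrange : ∀ {c n k j : ℤ} → c ℤ.+ k ≡ n ℤ.+ j → c ℤ.- n ℤ.+ k ≡ j
    rearrange {c} {n} {k} {j} eq = ℤ-linear-combination eq (ℤ-Solver.solve (c ∷ n ∷ k ∷ j ∷ []))

-- t is a − c reduced modulo k+1 into [0, k].
data Offset (k a c t : ℕ) : Set where
  offset-≤ : c ≤ a → c + t ≡ a → Offset k a c t
  offset-> : a < c → c + t ≡ suc (k + a) → Offset k a c t

offset-equation : ∀ {k a c t} → Offset k a c t → t + c + suc k * toℕ (c ≤ᵇ a) ≡ k + a + 1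
offset-equation {k} {a} {c} {t} (offset-≤ c≤a c+t≡a) rewrite toℕ-≤ᵇ-yes c≤a =
  linear-combination c+t≡a (solve (k ∷ a ∷ c ∷ t ∷ []))
offset-equation {k} {a} {c} {t} (offset-> a<c c+t≡) rewrite toℕ-≤ᵇ-no (<⇒≱ a<c) =
  linear-combination c+t≡ (solve (k ∷ a ∷ c ∷ t ∷ []))

weight-← : ∀ {k m σ c t} → InA (suc m) k σ → Admissible k (suc (suc m)) c → Offset k (lastOr0 σ) c t →
  weight k (suc (suc m)) (σ ← c) + t ≡ weight k (suc m) σ + k
weight-← {σ = []} (σ↭ , _) with length-↭-range σ↭
... | ()
weight-← {k} {m} {x ∷ xs} {c} {t} σ∈A c-adm offset
  rewrite des-← x xs c | lastOr0-++ (map (shiftUp c) (x ∷ xs)) c =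
  shifted-weight _ _ _ _ _ (offset-equation offset) (c+k≡n+[c+k∸n] c-adm) (c+k≡n+[c+k∸n] (last-admissible σ∈A))
  where
  shifted-weight : ∀ d b a j j₀ → t + c + suc k * b ≡ k + a + 1 → c + k ≡ suc (suc m) + j → a + k ≡ suc m + j₀ →
    suc k * (d + b) + j + t ≡ suc k * d + j₀ + k
  shifted-weight d b a j j₀ offset′ c+k≡ a+k≡ = linear-combination (cong₂ _+_ offset′ (cong₂ _+_ (sym c+k≡) a+k≡))
    (solve (k ∷ m ∷ c ∷ t ∷ d ∷ b ∷ a ∷ j ∷ j₀ ∷ []))

offset-exists : ∀ {k m a c} → Admissible k m a → Admissible k (suc m) c → ∃ λ t → t ≤ k × Offset k a c t
offset-exists {k} {m} {a} {c} (admissible _ a≤m m≤a+k) (admissible _ c≤1+m 1+m≤c+k) with c ≤? a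
... | yes c≤a = let t , c+t≡a = m≤n⇒∃[o]m+o≡n c≤a in
  t , +-cancelˡ-≤ c t k (begin
    c + t  ≡⟨ c+t≡a ⟩
    a      ≤⟨ m≤n⇒m≤1+n a≤m ⟩
    suc m  ≤⟨ 1+m≤c+k ⟩
    c + k  ∎) , offset-≤ c≤a c+t≡a
  where open ≤-Reasoning
... | no c≰a = let t , c+t≡ = m≤n⇒∃[o]m+o≡n c≤1+k+a in
  t , +-cancelˡ-≤ c t k (begin
    c + t        ≡⟨ c+t≡ ⟩
    suc (k + a)  ≡⟨ +-suc k a ⟨
    k + suc a    ≤⟨ +-monoʳ-≤ k (≰⇒> c≰a) ⟩
    k + c        ≡⟨ +-comm k c ⟩
    c + k        ∎) , offset-> (≰⇒> c≰a) c+t≡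
  where
  open ≤-Reasoning
  c≤1+k+a : c ≤ suc (k + a)
  c≤1+k+a = ≤-trans c≤1+m (s≤s (≤-trans m≤a+k (≤-reflexive (+-comm a k))))

last-sum : ∀ {k M a a* d d*} → M < k → Admissible k M a → Admissible k M a* →
  suc k * d* + (a* + k ∸ M) + (suc k * d + (a + k ∸ M)) ≡ suc M * k → a + a* ≡ suc M
last-sum {k} {M} {a} {a*} {d} {d*} M<k a-adm a*-adm weights with m≤n⇒∃[o]m+o≡n M<k
... | w , 1+M+w≡k = from-j-indices (c+k≡n+[c+k∸n] a-adm) (c+k≡n+[c+k∸n] a*-adm) (c+k∸n≤k a-adm) (c+k∸n≤k a*-adm) weights
  where
  1+w≤k : suc w ≤ k
  1+w≤k = ≤-trans (s≤s (m≤n+m w M)) (≤-reflexive 1+M+w≡k)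
  from-j-indices : ∀ {j j*} → a + k ≡ M + j → a* + k ≡ M + j* → j ≤ k → j* ≤ k →
    suc k * d* + j* + (suc k * d + j) ≡ suc M * k → a + a* ≡ suc M
  from-j-indices {j} {j*} a+k≡ a*+k≡ j≤k j*≤k weights′ with j* + j ≤? k
  ... | yes Y≤k = contradiction (linear-combination {l = suc (a + a* + w)} {r = 0}
          (cong₂ _+_ a+k≡ (cong₂ _+_ a*+k≡ (cong₂ _+_ Y≡1+w (cong₂ _+_ 1+M+w≡k 1+M+w≡k))))
          (solve (k ∷ M ∷ a ∷ a* ∷ w ∷ j ∷ j* ∷ []))) 1+n≢0
    where
    Y≡1+w : j* + j ≡ suc w
    Y≡1+w = proj₂ (divmod-unique (suc k) {d* + d} {M} (s≤s Y≤k) (s≤s 1+w≤k)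
      (linear-combination (cong₂ _+_ weights′ (sym 1+M+w≡k)) (solve (k ∷ M ∷ w ∷ d ∷ d* ∷ j ∷ j* ∷ []))))
  ... | no Y≰k with m≤n⇒∃[o]m+o≡n (≰⇒> Y≰k)
  ...   | Y′ , 1+k+Y′≡Y = linear-combination
          (cong₂ _+_ a+k≡ (cong₂ _+_ a*+k≡ (cong₂ _+_ (sym 1+k+Y′≡Y) (cong₂ _+_ Y′≡1+w 1+M+w≡k))))
          (solve (k ∷ M ∷ a ∷ a* ∷ w ∷ j ∷ j* ∷ Y′ ∷ []))
    where
    Y′<k : Y′ < k
    Y′<k = +-cancelˡ-< k Y′ k (begin-strict
      k + Y′      <⟨ n<1+n (k + Y′) ⟩
      suc k + Y′  ≡⟨ 1+k+Y′≡Y ⟩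
      j* + j      ≤⟨ +-mono-≤ j*≤k j≤k ⟩
      k + k       ∎)
      where open ≤-Reasoning
    Y′≡1+w : Y′ ≡ suc w
    Y′≡1+w = proj₂ (divmod-unique (suc k) {suc (d* + d)} {M} (m<n⇒m<1+n Y′<k) (s≤s 1+w≤k)
      (linear-combination (cong₂ _+_ weights′ (cong₂ _+_ 1+k+Y′≡Y (sym 1+M+w≡k)))
        (solve (k ∷ M ∷ w ∷ d ∷ d* ∷ j ∷ j* ∷ Y′ ∷ []))))

offset-wraps : ∀ {k M a a* c t} → (M < k → a + a* ≡ suc M) → Admissible k (suc M) c → Offset k a c t →
  suc M ≤ a* + t → k < a* + t
offset-wraps {k} {M} {a} {a*} {c} {t} mirror c-adm off 1+M≤a*+t with M <? k
... | no M≮k = ≤-trans (s≤s (≮⇒≥ M≮k)) 1+M≤a*+t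
... | yes M<k with mirror M<k | c-adm | off
...   | a+a*≡ | admissible 1≤c _ _ | offset-≤ _ c+t≡a = contradiction 1+M≤a*+t (<⇒≱ (begin-strict
  a* + t      <⟨ m<m+n (a* + t) 1≤c ⟩
  a* + t + c  ≡⟨ linear-combination (cong₂ _+_ a+a*≡ c+t≡a) (solve (M ∷ a ∷ a* ∷ c ∷ t ∷ [])) ⟩
  suc M       ∎))
  where open ≤-Reasoning
...   | a+a*≡ | admissible _ c≤1+M _ | offset-> _ c+t≡ = +-cancelʳ-≤ (suc M) (suc k) (a* + t) (begin
  suc k + suc M   ≡⟨ linear-combination (cong₂ _+_ (sym a+a*≡) (sym c+t≡)) (solve (k ∷ M ∷ a ∷ a* ∷ c ∷ t ∷ [])) ⟩
  a* + t + c      ≤⟨ +-monoʳ-≤ (a* + t) c≤1+M ⟩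
  a* + t + suc M  ∎)
  where open ≤-Reasoning

-- The partner is a + t + 1 when that fits below suc m, and a + t − k otherwise; the last
-- hypothesis keeps the latter positive.
offset-partner : ∀ {k m a t w} → Admissible k m a → t + w ≡ k → (suc m ≤ a + t → k < a + t) →
  ∃ λ c → Admissible k (suc m) c × Offset k a c w
offset-partner {k} {m} {a} {t} {w} (admissible _ a≤m m≤a+k) t+w≡k wraps with suc m ≤? a + t
... | no 1+m≰a+t = suc (a + t) , admissible (s≤s z≤n) (≰⇒> 1+m≰a+t) (s≤s m≤a+t+k)
  , offset-> (s≤s (m≤m+n a t)) (linear-combination t+w≡k (solve (k ∷ a ∷ t ∷ w ∷ [])))
  where
  m≤a+t+k : m ≤ a + t + k
  m≤a+t+k = ≤-trans m≤a+k (+-monoˡ-≤ k (m≤m+n a t))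
... | yes 1+m≤a+t with m≤n⇒∃[o]m+o≡n (wraps 1+m≤a+t)
...   | e , 1+k+e≡a+t = suc e , admissible (s≤s z≤n) (≤-trans (1+e≤a 1+k+e≡a+t) (m≤n⇒m≤1+n a≤m))
          (≤-trans 1+m≤a+t (≤-reflexive (linear-combination (sym 1+k+e≡a+t) (solve (k ∷ a ∷ t ∷ e ∷ [])))))
  , offset-≤ (1+e≤a 1+k+e≡a+t) (linear-combination (cong₂ _+_ 1+k+e≡a+t t+w≡k) (solve (k ∷ a ∷ t ∷ w ∷ e ∷ [])))
  where
  1+e≤a : ∀ {e} → suc k + e ≡ a + t → suc e ≤ a
  1+e≤a {e} 1+k+e≡a+t = +-cancelʳ-≤ k (suc e) a (begin
    suc e + k  ≡⟨ solve (k ∷ e ∷ []) ⟩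
    suc k + e  ≡⟨ 1+k+e≡a+t ⟩
    a + t      ≤⟨ +-monoʳ-≤ a (m≤m+n t w) ⟩
    a + (t + w) ≡⟨ cong (a ℕ.+_) t+w≡k ⟩
    a + k      ∎)
    where open ≤-Reasoning

module _ {k n i j : ℕ} where

  private
    K : ℤ
    K = + suc k

  divmod⇒i′-j′ : ∀ {q r} → r ≤ k → suc k * q + r + (suc k * i + j) ≡ suc n * k →
    i′ k n (+ i) (+ j) ≡ + q × j′ k n (+ i) (+ j) ≡ + r
  divmod⇒i′-j′ {q} {r} r≤k weights = i′≡q , j′≡r
    where
    complement : ∀ {N K I J X : ℤ} → X ℤ.+ (K ℤ.* I ℤ.+ J) ≡ N → N ℤ.- K ℤ.* I ℤ.- J ≡ X
    complement {N} {K} {I} {J} {X} eq = ℤ-linear-combination (sym eq) (ℤ-Solver.solve (N ∷ K ∷ I ∷ J ∷ X ∷ []))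
    remainder : ∀ {K Q R : ℤ} → (K ℤ.* Q ℤ.+ R) ℤ.- K ℤ.* Q ≡ R
    remainder {K} {Q} {R} = ℤ-Solver.solve (K ∷ Q ∷ R ∷ [])
    bigN≡ : bigN k n (+ i) (+ j) ≡ + (suc k * q + r)
    bigN≡ = complement {+ (suc n * k)} {K} {+ i} {+ j} {+ (suc k * q + r)}
      (trans (cong (λ W → + (suc k * q + r) ℤ.+ W) (sym (pos-*-+ (suc k) i j))) (cong +_ weights))
    i′≡q : i′ k n (+ i) (+ j) ≡ + q
    i′≡q = trans (cong (ℤ._/ℕ suc k) bigN≡) (cong +_ ([m*n+o]/m≡n (suc k) q (s≤s r≤k)))
    j′≡r : j′ k n (+ i) (+ j) ≡ + r
    j′≡r = trans (cong₂ (λ N Q → N ℤ.- K ℤ.* Q) (trans bigN≡ (pos-*-+ (suc k) q r)) i′≡q) (remainder {K} {+ q} {+ r})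

  i′-j′⇒divmod : ∀ {q r} → i′ k n (+ i) (+ j) ≡ + q → j′ k n (+ i) (+ j) ≡ + r →
    suc k * q + r + (suc k * i + j) ≡ suc n * k
  i′-j′⇒divmod {q} {r} i′≡q j′≡r = ℤ.+-injective (begin
    + (suc k * q + r + (suc k * i + j))           ≡⟨ cong₂ ℤ._+_ (pos-*-+ (suc k) q r) (pos-*-+ (suc k) i j) ⟩
    K ℤ.* + q ℤ.+ + r ℤ.+ (K ℤ.* + i ℤ.+ + j)     ≡⟨ recombine {+ (suc n * k)} {K} {+ i} {+ j} {+ q} {+ r} big-j′≡r ⟩
    + (suc n * k)                                 ∎)
    where
    open ≡-Reasoning
    recombine : ∀ {N K I J Q R : ℤ} → N ℤ.- K ℤ.* I ℤ.- J ℤ.- K ℤ.* Q ≡ R → K ℤ.* Q ℤ.+ R ℤ.+ (K ℤ.* I ℤ.+ J) ≡ N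
    recombine {N} {K} {I} {J} {Q} {R} eq = ℤ-linear-combination (sym eq) (ℤ-Solver.solve (N ∷ K ∷ I ∷ J ∷ Q ∷ R ∷ []))
    big-j′≡r : bigN k n (+ i) (+ j) ℤ.- K ℤ.* + q ≡ + r
    big-j′≡r = trans (cong (λ Q → bigN k n (+ i) (+ j) ℤ.- K ℤ.* Q) (sym i′≡q)) j′≡r

Γ-intro : ∀ {k m π I J} → InA (suc m) k π → + des π ≡ I → + jIndex k (suc m) π ≡ J → InΓ k (suc m) I J π
Γ-intro π∈A refl refl = π∈A , refl , sym (n-k+[c+k∸n]≡c (last-admissible π∈A))

Γ-elim : ∀ {k m π I J} → InΓ k (suc m) I J π → InA (suc m) k π × + des π ≡ I × + jIndex k (suc m) π ≡ J
Γ-elim {k} {m} {π} {I} {J} (π∈A , des≡I , last≡) = π∈A , des≡I ,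
  cancelˡ {+ suc m ℤ.- + k} (trans (n-k+[c+k∸n]≡c (last-admissible π∈A)) last≡)
  where
  cancelˡ : ∀ {x y z : ℤ} → x ℤ.+ y ≡ x ℤ.+ z → y ≡ z
  cancelˡ {x} {y} {z} eq = ℤ-linear-combination eq (ℤ-Solver.solve (x ∷ y ∷ z ∷ []))

φ-unfold : ∀ {k m π ρ} → InA (suc (suc m)) k π → InA (suc (suc m)) k ρ →
  weight k (suc (suc m)) ρ + weight k (suc (suc m)) π ≡ suc (suc (suc m)) * k →
  φ k (suc (suc m)) π ≡ φ k (suc m) (std π) ← lastOr0 ρ
φ-unfold {k} {m} {π} {ρ} π∈A ρ∈A weights = cong (φ k (suc m) (std π) ←_) (cong ∣_∣ (begin
  (+ n ℤ.- + k) ℤ.+ j′ k n (+ des π) (+ lastOr0 π ℤ.- + n ℤ.+ + k)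
    ≡⟨ cong (λ J → (+ n ℤ.- + k) ℤ.+ j′ k n (+ des π) J) (c-n+k≡c+k∸n (last-admissible π∈A)) ⟩
  (+ n ℤ.- + k) ℤ.+ j′ k n (+ des π) (+ jIndex k n π)
    ≡⟨ cong (λ J → (+ n ℤ.- + k) ℤ.+ J) (proj₂ (divmod⇒i′-j′ {k} {n} {des π} {jIndex k n π} {des ρ} (c+k∸n≤k (last-admissible ρ∈A)) weights)) ⟩
  (+ n ℤ.- + k) ℤ.+ + jIndex k n ρ
    ≡⟨ n-k+[c+k∸n]≡c (last-admissible ρ∈A) ⟩
  + lastOr0 ρ ∎))
  where
  open ≡-Reasoning
  n : ℕ
  n = suc (suc m)

φ-involution : ∀ k m π → InA (suc m) k π →
  InA (suc m) k (φ k (suc m) π)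
  × weight k (suc m) (φ k (suc m) π) + weight k (suc m) π ≡ suc (suc m) * k
  × φ k (suc m) (φ k (suc m) π) ≡ π
φ-involution k zero π (π↭ , _) with ↭-singleton-inv π↭
... | refl = (↭-refl , z≤n) , k+k≡2k , refl
  where
  k+k≡2k : k * 0 + k + (k * 0 + k) ≡ 2 * k
  k+k≡2k = solve (k ∷ [])
φ-involution k (suc m) π π∈A
  with ∈A-decompose π∈A
... | σ∈A , c-adm , σ←c≡π
  with φ-involution k m (std π) σ∈A
... | σ*∈A , σ-weights , σ**≡σ
  with offset-exists (last-admissible σ∈A) c-adm
... | t , t≤k , offset
  with m≤n⇒∃[o]m+o≡n t≤k
... | w , t+w≡k
  with offset-partner (last-admissible σ*∈A) t+w≡k (offset-wraps mirror c-adm offset)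
  where
  mirror : suc m < k → lastOr0 (std π) + lastOr0 (φ k (suc m) (std π)) ≡ suc (suc m)
  mirror M<k = last-sum {d = des (std π)} {d* = des (φ k (suc m) (std π))}
    M<k (last-admissible σ∈A) (last-admissible σ*∈A) σ-weights
... | c′ , c′-adm , offset′ =
  subst (InA n k) (sym φπ≡ρ) ρ∈A ,
  subst (λ φπ → weight k n φπ + weight k n π ≡ suc n * k) (sym φπ≡ρ) weights ,
  trans (cong (φ k n) φπ≡ρ) φρ≡π
  where
  M n : ℕ
  M = suc m
  n = suc M
  σ* ρ : List ℕ
  σ* = φ k M (std π)
  ρ = σ* ← c′
  ρ∈A : InA n k ρ
  ρ∈A = ←-∈A σ*∈A c′-adm
  weights : weight k n ρ + weight k n π ≡ suc n * k
  weights = weight-sum (weight-← σ*∈A c′-adm offset′)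
    (subst (λ τ → weight k n τ + t ≡ weight k M (std π) + k) σ←c≡π (weight-← σ∈A c-adm offset)) σ-weights
    where
    weight-sum : ∀ {Wρ Wπ Wσ Wσ*} → Wρ + w ≡ Wσ* + k → Wπ + t ≡ Wσ + k → Wσ* + Wσ ≡ suc (suc m) * k →
      Wρ + Wπ ≡ suc (suc (suc m)) * k
    weight-sum {Wρ} {Wπ} {Wσ} {Wσ*} ρ-step π-step partners = linear-combination
      (cong₂ _+_ ρ-step (cong₂ _+_ π-step (cong₂ _+_ partners (sym t+w≡k))))
      (solve (k ∷ m ∷ t ∷ w ∷ Wρ ∷ Wπ ∷ Wσ ∷ Wσ* ∷ []))
  φπ≡ρ : φ k n π ≡ ρ
  φπ≡ρ = trans (φ-unfold π∈A ρ∈A weights) (cong (σ* ←_) (lastOr0-++ (map (shiftUp c′) σ*) c′))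
  φρ≡π : φ k n ρ ≡ π
  φρ≡π = begin
    φ k n ρ                    ≡⟨ φ-unfold ρ∈A π∈A (trans (+-comm (weight k n π) (weight k n ρ)) weights) ⟩
    φ k M (std ρ) ← lastOr0 π  ≡⟨ cong (λ τ → φ k M τ ← lastOr0 π) (std-← σ* c′) ⟩
    φ k M σ* ← lastOr0 π       ≡⟨ cong (_← lastOr0 π) σ**≡σ ⟩
    std π ← lastOr0 π          ≡⟨ σ←c≡π ⟩
    π                          ∎
    where open ≡-Reasoning

φ-involutive : ∀ {k m π} → InA (suc m) k π → φ k (suc m) (φ k (suc m) π) ≡ π
φ-involutive {k} {m} {π} π∈A = proj₂ (proj₂ (φ-involution k m π π∈A))

module _ {k m i j : ℕ} where

  private
    n : ℕ
    n = suc m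

  φ-Γ⇒Γ′ : ∀ {π} → InΓ k n (+ i) (+ j) π → InΓ k n (i′ k n (+ i) (+ j)) (j′ k n (+ i) (+ j)) (φ k n π)
  φ-Γ⇒Γ′ {π} πΓ with Γ-elim πΓ
  ... | π∈A , refl , jIndex≡j with φ-involution k m π π∈A
  ...   | φπ∈A , weights , _ with divmod⇒i′-j′ {k} {n} {i} {j} (c+k∸n≤k (last-admissible φπ∈A))
          (subst (λ r → weight k n (φ k n π) + (suc k * i + r) ≡ suc n * k) (ℤ.+-injective jIndex≡j) weights)
  ...     | i′≡ , j′≡ = Γ-intro φπ∈A (sym i′≡) (sym j′≡)

  φ-Γ′⇒Γ : ∀ {τ} → j ≤ k → InΓ k n (i′ k n (+ i) (+ j)) (j′ k n (+ i) (+ j)) τ → InΓ k n (+ i) (+ j) (φ k n τ)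
  φ-Γ′⇒Γ {τ} j≤k τΓ with Γ-elim τΓ
  ... | τ∈A , des≡i′ , jIndex≡j′ with φ-involution k m τ τ∈A
  ...   | π∈A , weights , _ = Γ-intro π∈A (cong +_ (proj₁ π-quotient)) (cong +_ (proj₂ π-quotient))
    where
    complement : weight k n τ + (suc k * i + j) ≡ suc n * k
    complement = i′-j′⇒divmod {k} {n} {i} {j} (sym des≡i′) (sym jIndex≡j′)
    π-quotient : des (φ k n τ) ≡ i × jIndex k n (φ k n τ) ≡ j
    π-quotient = divmod-unique (suc k) (s≤s (c+k∸n≤k (last-admissible π∈A))) (s≤s j≤k)
      (+-cancelʳ-≡ (weight k n τ) _ _ (trans weights (trans (sym complement) (+-comm (weight k n τ) _))))

theorem2p1 : (n k i j : ℕ) → 1 ≤ n → i < n → j ≤ k →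
    ((π : List ℕ) → InΓ k n (+ i) (+ j) π →
        InΓ k n (i′ k n (+ i) (+ j)) (j′ k n (+ i) (+ j)) (φ k n π))
    × ((π σ : List ℕ) → InΓ k n (+ i) (+ j) π → InΓ k n (+ i) (+ j) σ →
        φ k n π ≡ φ k n σ → π ≡ σ)
    × ((τ : List ℕ) → InΓ k n (i′ k n (+ i) (+ j)) (j′ k n (+ i) (+ j)) τ →
        Σ (List ℕ) (λ π → InΓ k n (+ i) (+ j) π × φ k n π ≡ τ))
theorem2p1 (suc m) k i j _ _ j≤k =
    (λ _ → φ-Γ⇒Γ′)
  , (λ π σ πΓ σΓ φπ≡φσ → begin
      π                          ≡⟨ φ-involutive (proj₁ πΓ) ⟨
      φ k (suc m) (φ k (suc m) π)  ≡⟨ cong (φ k (suc m)) φπ≡φσ ⟩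
      φ k (suc m) (φ k (suc m) σ)  ≡⟨ φ-involutive (proj₁ σΓ) ⟩
      σ                          ∎)
  , (λ τ τΓ → φ k (suc m) τ , φ-Γ′⇒Γ j≤k τΓ , φ-involutive (proj₁ τΓ))
  where open ≡-Reasoning
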